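{- Let $H$ be a finite simple $k$-regular graph with $|V(H)|\geq 3$ and $\chi_\delta(H)\geq 2$, and let $G=\{u\}\vee H$ be the join of a single new vertex $u$ with $H$ (i.e., $G$ is obtained from $H$ by adding a vertex $u$ adjacent to every vertex of $H$). If $|V(H)|>k+2$, then $\chi_\delta(G\square P_3)\leq 2\chi_\delta(H)$.
   Context: All graphs are finite and simple; $P_3$ is the path on 3 vertices; $d_G(x)$ denotes the degree of $x$ in $G$. The $\delta$-complement $G_\delta$ of a graph $G$ is the graph on $V(G)$ in which distinct $u,v$ are adjacent iff either ($d_G(u)=d_G(v)$ and $uv\notin E(G)$) or ($d_G(u)\neq d_G(v)$ and $uv\in E(G)$). The $\delta$-chromatic number $\chi_\delta(G)$ is the chromatic number of $G_\delta$. The Cartesian product $G\square H$ has vertex set $V(G)\times V(H)$, with $(x,y)$ adjacent to $(x',y')$ iff either $x=x'$ and $yy'\in E(H)$, or $y=y'$ and $xx'\in E(G)$. -}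

module Defs where

open import Data.Nat using (ℕ; zero; suc; _+_; _*_; _<_)
open import Data.Nat.Properties using (_≟_)
open import Data.Bool using (Bool; true; false; if_then_else_; not; _∧_; _∨_)
open import Data.Fin using (Fin; zero; suc; remQuot)
open import Data.Fin.Properties using () renaming (_≟_ to _≟ᶠ_)
open import Data.List using (List; length; filter)
open import Data.List using () renaming (allFin to allFinL)
open import Data.Product using (Σ; _×_; _,_; proj₁; proj₂)
open import Relation.Binary.PropositionalEquality using (_≡_; _≢_)
open import Relation.Nullary using (¬_; does)

Adj : ℕ → Set
Adj n = Fin n → Fin n → Bool

record IsSimple {n : ℕ} (A : Adj n) : Set where
  field
    sym   : ∀ x y → A x y ≡ A y x
    irrefl : ∀ x → A x x ≡ false

deg : {n : ℕ} → Adj n → Fin n → ℕ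
deg {n} A x = length (filter (λ y → A x y ≡? true) (allFinL n))
  where
    open import Data.Bool.Properties using () renaming (_≟_ to _≡?_)

Regular : {n : ℕ} → Adj n → ℕ → Set
Regular A k = ∀ x → deg A x ≡ k

deltaComp : {n : ℕ} → Adj n → Adj n
deltaComp A u v =
  if does (u ≟ᶠ v) then false
  else (if does (deg A u ≟ deg A v) then not (A u v) else A u v)

Colorable : {n : ℕ} → Adj n → ℕ → Set
Colorable {n} A c = Σ (Fin n → Fin c) λ f → ∀ x y → A x y ≡ true → f x ≢ f y

IsChromaticNumber : {n : ℕ} → Adj n → ℕ → Set
IsChromaticNumber A c = Colorable A c × (∀ m → m < c → ¬ Colorable A m)

IsDeltaChromaticNumber : {n : ℕ} → Adj n → ℕ → Set
IsDeltaChromaticNumber A c = IsChromaticNumber (deltaComp A) c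

-- join {u} ∨ H : new vertex u = zero, adjacent to every vertex of H
joinVertex : {n : ℕ} → Adj n → Adj (suc n)
joinVertex A zero    zero    = false
joinVertex A zero    (suc y) = true
joinVertex A (suc x) zero    = true
joinVertex A (suc x) (suc y) = A x y

P3 : Adj 3
P3 zero          (suc zero)    = true
P3 (suc zero)    zero          = true
P3 (suc zero)    (suc (suc zero)) = true
P3 (suc (suc zero)) (suc zero) = true
P3 _ _ = false

-- Cartesian product G □ H on Fin (m * n), vertex i ↔ remQuot n i = (x , y)
cart : {m n : ℕ} → Adj m → Adj n → Adj (m * n)
cart {m} {n} G H i j with remQuot {m} n i | remQuot {m} n j
... | (x , y) | (x' , y') =
  (does (x ≟ᶠ x') ∧ H y y') ∨ (does (y ≟ᶠ y') ∧ G x x')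

{-# OPTIONS --safe #-}
module Submission where

-- In G □ P₃ the vertex (x , p) has degree deg_G x + deg_P₃ p, so n > k + 2 makes every apex copy
-- (degree ≥ n + 1) differ in degree from every copy of a vertex of H (degree ≤ k + 3).  As H is
-- regular, a δ-colouring f of H is a colouring of its complement: its colour classes are cliques of H.
-- Colour the copies of H in layers 0 and 2 by f from two disjoint palettes, those in layer 1 by a
-- cyclic shift of f (so that they differ from layer 0 at the same vertex of H), and the three apex
-- copies by distinct colours not used in their own layer.  In every colour class two vertices are
-- then adjacent exactly when their degrees agree, i.e. the class is independent in the δ-complement.

open import Defs
open import Data.Nat using (ℕ; suc; _+_; _*_; _≤_; _<_; _≥_; _>_; z≤n; s≤s)
open import Data.Product using (_×_; _,_; proj₁; proj₂; uncurry)
open import Algebra.Bundles using (Monoid; CommutativeMonoid)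
open import Data.Bool using (Bool; true; false; _∧_; _∨_; _xor_)
open import Data.Bool.Properties using (∧-zeroʳ; ∨-identityʳ; xor-same) renaming (_≟_ to _≟ᵇ_)
open import Data.Fin using (Fin; zero; suc; _↑ˡ_; _↑ʳ_; combine; remQuot; punchIn; fromℕ; inject₁; toℕ)
open import Data.Fin.Patterns using (0F; 1F; 2F)
open import Data.Fin.Properties
  using (combine-remQuot; remQuot-combine; combine-injective; punchInᵢ≢i;
         fromℕ≢inject₁; inject₁-injective; toℕ-inject₁)
  renaming (_≟_ to _≟ᶠ_)
open import Data.List using (length; filter; tabulate)
open import Data.Nat.Properties
  using (_≟_; +-0-commutativeMonoid; +-comm; +-monoʳ-≤; +-cancelˡ-≡; m<m+n; 1+n≢n; <⇒≢; >⇒≢;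
         module ≤-Reasoning)
open import Function using (id; _∘_)
open import Relation.Binary.PropositionalEquality
  using (_≡_; _≢_; refl; sym; trans; cong; cong₂; module ≡-Reasoning)
open import Relation.Nullary using (Dec; does; yes; no; contradiction)
open import Relation.Nullary.Decidable using (dec-true; dec-false)

private variable
  m n c : ℕ

module MonoidSum {a ℓ} (M : Monoid a ℓ) where

  open Monoid M using (Carrier; _≈_; _∙_; ∙-congˡ; identityˡ; assoc)
    renaming (refl to ≈-refl; sym to ≈-sym; trans to ≈-trans)
  open import Algebra.Properties.Monoid.Sum M using (sum)

  ∑-++ : ∀ m {n} (g : Fin (m + n) → Carrier) → sum g ≈ sum (g ∘ (_↑ˡ n)) ∙ sum (g ∘ (m ↑ʳ_))
  ∑-++ 0       g = ≈-sym (identityˡ _)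
  ∑-++ (suc m) g = ≈-trans (∙-congˡ (∑-++ m (g ∘ suc))) (≈-sym (assoc _ _ _))

  ∑-combine : ∀ m n (g : Fin (m * n) → Carrier) → sum g ≈ sum {m} (λ x → sum {n} (λ y → g (combine x y)))
  ∑-combine 0       n g = ≈-refl
  ∑-combine (suc m) n g = ≈-trans (∑-++ n g) (∙-congˡ (∑-combine m n (g ∘ (n ↑ʳ_))))

module CommutativeMonoidSum {a ℓ} (M : CommutativeMonoid a ℓ) where

  open CommutativeMonoid M using (Carrier; _≈_; _∙_; ε; ∙-congˡ; identityʳ; setoid; monoid)
  open import Algebra.Properties.CommutativeMonoid.Sum M
    using (sum; sum-remove; sum-cong-≋; sum-replicate-zero)
  open import Relation.Binary.Reasoning.Setoid setoid
  open MonoidSum monoid public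

  ∑-supported : ∀ {n} (g : Fin n → Carrier) i → (∀ j → j ≢ i → g j ≈ ε) → sum g ≈ g i
  ∑-supported {suc n} g i vanishes = begin
    sum g                                  ≈⟨ sum-remove g ⟩
    g i ∙ sum (λ j → g (punchIn i j))      ≈⟨ ∙-congˡ (sum-cong-≋ (vanishes _ ∘ punchInᵢ≢i i)) ⟩
    g i ∙ sum {n} (λ _ → ε)                ≈⟨ ∙-congˡ (sum-replicate-zero n) ⟩
    g i ∙ ε                                ≈⟨ identityʳ (g i) ⟩
    g i                                    ∎

open CommutativeMonoidSum +-0-commutativeMonoid
open import Algebra.Properties.CommutativeMonoid.Sum +-0-commutativeMonoid
  using (sum; sum-syntax; sum-cong-≗; sum-remove)

𝟙 : Bool → ℕ
𝟙 true  = 1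
𝟙 false = 0

length-filter-tabulate : ∀ {n} {X : Set} (t : Fin n → X) (b : X → Bool) →
  length (filter (λ x → b x ≟ᵇ true) (tabulate t)) ≡ ∑[ i < n ] 𝟙 (b (t i))
length-filter-tabulate {0}     t b = refl
length-filter-tabulate {suc n} t b with b (t zero)
... | true  = cong suc (length-filter-tabulate (t ∘ suc) b)
... | false = length-filter-tabulate (t ∘ suc) b

deg≡∑ : (A : Adj n) (x : Fin n) → deg A x ≡ ∑[ y < n ] 𝟙 (A x y)
deg≡∑ A x = length-filter-tabulate id (A x)

deg≡∑-punchIn : (A : Adj (suc n)) (x : Fin (suc n)) → A x x ≡ false →
  deg A x ≡ ∑[ j < n ] 𝟙 (A x (punchIn x j))
deg≡∑-punchIn {n} A x Axx = begin
  deg A x                             ≡⟨ deg≡∑ A x ⟩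
  ∑[ y < suc n ] 𝟙 (A x y)            ≡⟨ sum-remove {i = x} (𝟙 ∘ A x) ⟩
  𝟙 (A x x) + rest                    ≡⟨ cong (λ b → 𝟙 b + rest) Axx ⟩
  rest                                ∎
  where
  open ≡-Reasoning
  rest = ∑[ j < n ] 𝟙 (A x (punchIn x j))

deltaComp-refl : (A : Adj n) (x : Fin n) → deltaComp A x x ≡ false
deltaComp-refl A x rewrite dec-true (x ≟ᶠ x) refl = refl

deltaComp-≢ : (A : Adj n) {x y : Fin n} → x ≢ y → deltaComp A x y ≡ does (deg A x ≟ deg A y) xor A x y
deltaComp-≢ A {x} {y} x≢y rewrite dec-false (x ≟ᶠ y) x≢y with does (deg A x ≟ deg A y)
... | true  = refl
... | false = refl

δ-coloring : (A : Adj n) (f : Fin n → Fin c) →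
  (∀ x y → x ≢ y → f x ≡ f y → A x y ≡ does (deg A x ≟ deg A y)) →
  Colorable (deltaComp A) c
δ-coloring A f agrees = f , λ x y δxy fx≡fy →
  contradiction (trans (sym δxy) (nonadjacent fx≡fy (x ≟ᶠ y))) λ ()
  where
  open ≡-Reasoning
  nonadjacent : ∀ {x y} → f x ≡ f y → Dec (x ≡ y) → deltaComp A x y ≡ false
  nonadjacent {x} _     (yes refl) = deltaComp-refl A x
  nonadjacent {x} {y} fx≡fy (no x≢y) = begin
    deltaComp A x y   ≡⟨ deltaComp-≢ A x≢y ⟩
    d xor A x y       ≡⟨ cong (d xor_) (agrees x y x≢y fx≡fy) ⟩
    d xor d           ≡⟨ xor-same d ⟩
    false             ∎
    where d = does (deg A x ≟ deg A y)

δ-sameColor⇒adjacent : (A : Adj n) → ((f , _) : Colorable (deltaComp A) c) →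
  ∀ {x y} → x ≢ y → deg A x ≡ deg A y → f x ≡ f y → A x y ≡ true
δ-sameColor⇒adjacent A (f , proper) {x} {y} x≢y same fx≡fy with A x y in Axy
... | true  = refl
... | false = contradiction fx≡fy
  (proper x y (trans (deltaComp-≢ A x≢y) (cong₂ _xor_ (dec-true (_ ≟ _) same) Axy)))

-- `cart G P i j` unfolds definitionally to `(G □ P) (remQuot n i) (remQuot n j)`.
_□_ : Adj m → Adj n → Fin m × Fin n → Fin m × Fin n → Bool
(G □ P) (x , y) (x' , y') = (does (x ≟ᶠ x') ∧ P y y') ∨ (does (y ≟ᶠ y') ∧ G x x')

deg□ : Adj m → Adj n → Fin m × Fin n → ℕ
deg□ G P (x , y) = deg G x + deg P y

module _ (G : Adj m) (P : Adj n) where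

  □-fibre : ∀ {x y y'} → G x x ≡ false → (G □ P) (x , y) (x , y') ≡ P y y'
  □-fibre {x} {y} {y'} Gxx
    rewrite dec-true (x ≟ᶠ x) refl | Gxx | ∧-zeroʳ (does (y ≟ᶠ y')) = ∨-identityʳ (P y y')

  □-layer : ∀ {x x' y} → x ≢ x' → (G □ P) (x , y) (x' , y) ≡ G x x'
  □-layer {x} {x'} {y} x≢x' rewrite dec-false (x ≟ᶠ x') x≢x' | dec-true (y ≟ᶠ y) refl = refl

  □-nonadjacent : ∀ {x x' y y'} → x ≢ x' → y ≢ y' → (G □ P) (x , y) (x' , y') ≡ false
  □-nonadjacent {x} {x'} {y} {y'} x≢x' y≢y'
    rewrite dec-false (x ≟ᶠ x') x≢x' | dec-false (y ≟ᶠ y') y≢y' = refl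

  ∑-fibre : ∀ {x y} → G x x ≡ false → ∑[ y' < n ] 𝟙 ((G □ P) (x , y) (x , y')) ≡ deg P y
  ∑-fibre {y = y} Gxx = trans (sum-cong-≗ (λ y' → cong 𝟙 (□-fibre {y = y} {y'} Gxx))) (sym (deg≡∑ P y))

  ∑-offFibre : ∀ {x x' y} → x ≢ x' → ∑[ y' < n ] 𝟙 ((G □ P) (x , y) (x' , y')) ≡ 𝟙 (G x x')
  ∑-offFibre {y = y} x≢x' = trans
    (∑-supported _ y (λ y' y'≢y → cong 𝟙 (□-nonadjacent x≢x' (y'≢y ∘ sym))))
    (cong 𝟙 (□-layer x≢x'))

∑□≡deg□ : (G : Adj m) (P : Adj n) → (∀ x → G x x ≡ false) →
  ∀ a → ∑[ x' < m ] ∑[ y' < n ] 𝟙 ((G □ P) a (x' , y')) ≡ deg□ G P a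
∑□≡deg□ {suc m} {n} G P G-irrefl (x , y) = begin
  ∑[ x' < suc m ] row x'                      ≡⟨ sum-remove {i = x} row ⟩
  row x + ∑[ j < m ] row (punchIn x j)       ≡⟨ cong₂ _+_ (∑-fibre G P (G-irrefl x))
                                                           (sum-cong-≗ (∑-offFibre G P ∘ x≢punchIn)) ⟩
  deg P y + ∑[ j < m ] 𝟙 (G x (punchIn x j)) ≡⟨ cong (deg P y +_) (deg≡∑-punchIn G x (G-irrefl x)) ⟨
  deg P y + deg G x                           ≡⟨ +-comm (deg P y) (deg G x) ⟩
  deg G x + deg P y                           ∎
  where
  open ≡-Reasoning
  row : Fin (suc m) → ℕ
  row x' = ∑[ y' < n ] 𝟙 ((G □ P) (x , y) (x' , y'))
  x≢punchIn : ∀ j → x ≢ punchIn x j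
  x≢punchIn j = punchInᵢ≢i x j ∘ sym

deg-cart : (G : Adj m) (P : Adj n) → (∀ x → G x x ≡ false) →
  ∀ i → deg (cart G P) i ≡ deg□ G P (remQuot n i)
deg-cart {m} {n} G P G-irrefl i = begin
  deg (cart G P) i                                                   ≡⟨ deg≡∑ (cart G P) i ⟩
  ∑[ j < m * n ] 𝟙 ((G □ P) a (remQuot n j))                         ≡⟨ ∑-combine m n _ ⟩
  ∑[ x' < m ] ∑[ y' < n ] 𝟙 ((G □ P) a (remQuot n (combine x' y')))  ≡⟨ sum-cong-≗ (sum-cong-≗ ∘ reindex) ⟩
  ∑[ x' < m ] ∑[ y' < n ] 𝟙 ((G □ P) a (x' , y'))                    ≡⟨ ∑□≡deg□ G P G-irrefl a ⟩
  deg□ G P a                                                         ∎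
  where
  open ≡-Reasoning
  a = remQuot n i
  reindex : ∀ x' y' → 𝟙 ((G □ P) a (remQuot n (combine x' y'))) ≡ 𝟙 ((G □ P) a (x' , y'))
  reindex x' y' = cong (𝟙 ∘ (G □ P) a) (remQuot-combine x' y')

cart-δ-coloring : (G : Adj m) (P : Adj n) → (∀ x → G x x ≡ false) → (g : Fin m × Fin n → Fin c) →
  (∀ a b → a ≢ b → g a ≡ g b → (G □ P) a b ≡ does (deg□ G P a ≟ deg□ G P b)) →
  Colorable (deltaComp (cart G P)) c
cart-δ-coloring {m} {n} G P G-irrefl g agrees = δ-coloring (cart G P) (g ∘ remQuot n) λ i j i≢j gi≡gj →
  trans (agrees _ _ (i≢j ∘ remQuot-injective) gi≡gj)
        (sym (cong₂ (λ d d' → does (d ≟ d')) (deg-cart G P G-irrefl i) (deg-cart G P G-irrefl j)))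
  where
  remQuot-injective : ∀ {i j} → remQuot {m} n i ≡ remQuot n j → i ≡ j
  remQuot-injective {i} {j} eq =
    trans (sym (combine-remQuot {m} n i)) (trans (cong (uncurry combine) eq) (combine-remQuot {m} n j))

joinVertex-irrefl : (H : Adj n) → (∀ x → H x x ≡ false) → ∀ x → joinVertex H x x ≡ false
joinVertex-irrefl H H-irrefl zero    = refl
joinVertex-irrefl H H-irrefl (suc x) = H-irrefl x

deg-joinVertex-apex : (H : Adj n) → deg (joinVertex H) zero ≡ n
deg-joinVertex-apex {n} H = trans (deg≡∑ (joinVertex H) zero) (∑-ones n)
  where
  ∑-ones : ∀ n → ∑[ i < n ] 1 ≡ n
  ∑-ones 0       = refl
  ∑-ones (suc n) = cong suc (∑-ones n)

deg-joinVertex-suc : (H : Adj n) (x : Fin n) → deg (joinVertex H) (suc x) ≡ suc (deg H x)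
deg-joinVertex-suc H x = trans (deg≡∑ (joinVertex H) (suc x)) (cong suc (sym (deg≡∑ H x)))

deg-P3-positive : ∀ p → 0 < deg P3 p
deg-P3-positive 0F = s≤s z≤n
deg-P3-positive 1F = s≤s z≤n
deg-P3-positive 2F = s≤s z≤n

deg-P3≤2 : ∀ p → deg P3 p ≤ 2
deg-P3≤2 0F = s≤s z≤n
deg-P3≤2 1F = s≤s (s≤s z≤n)
deg-P3≤2 2F = s≤s z≤n

cyclicPred : Fin (suc n) → Fin (suc n)
cyclicPred zero    = fromℕ _
cyclicPred (suc i) = inject₁ i

cyclicPred-injective : ∀ {i j : Fin (suc n)} → cyclicPred i ≡ cyclicPred j → i ≡ j
cyclicPred-injective {i = zero}  {zero}  _  = refl
cyclicPred-injective {i = zero}  {suc j} eq = contradiction eq fromℕ≢inject₁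
cyclicPred-injective {i = suc i} {zero}  eq = contradiction (sym eq) fromℕ≢inject₁
cyclicPred-injective {i = suc i} {suc j} eq = cong suc (inject₁-injective eq)

cyclicPred-fixedPointFree : ∀ (i : Fin (suc (suc n))) → cyclicPred i ≢ i
cyclicPred-fixedPointFree zero    ()
cyclicPred-fixedPointFree (suc i) eq = 1+n≢n (trans (sym (cong toℕ eq)) (toℕ-inject₁ i))

module JoinPathColoring {n k c : ℕ} (H : Adj n) (H-irrefl : ∀ x → H x x ≡ false)
  (H-regular : Regular H k) (gap : n > k + 2) (col : Colorable (deltaComp H) (suc (suc c))) where

  G : Adj (suc n)
  G = joinVertex H

  Vertex : Set
  Vertex = Fin (suc n) × Fin 3

  Palette : Set
  Palette = Fin 2 × Fin (suc (suc c))

  Agrees : Vertex → Vertex → Set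
  Agrees a b = (G □ P3) a b ≡ does (deg□ G P3 a ≟ deg□ G P3 b)

  f : Fin n → Fin (suc (suc c))
  f = proj₁ col

  f-classes-are-cliques : ∀ {h h'} → h ≢ h' → f h ≡ f h' → H h h' ≡ true
  f-classes-are-cliques h≢h' = δ-sameColor⇒adjacent H col h≢h' (trans (H-regular _) (sym (H-regular _)))

  deg□-apex : ∀ p → deg□ G P3 (zero , p) ≡ n + deg P3 p
  deg□-apex p = cong (_+ deg P3 p) (deg-joinVertex-apex H)

  deg□-base : ∀ h p → deg□ G P3 (suc h , p) ≡ suc k + deg P3 p
  deg□-base h p = cong (_+ deg P3 p) (trans (deg-joinVertex-suc H h) (cong suc (H-regular h)))

  deg□-base<apex : ∀ h p q → deg□ G P3 (suc h , p) < deg□ G P3 (zero , q)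
  deg□-base<apex h p q = begin-strict
    deg□ G P3 (suc h , p)   ≡⟨ deg□-base h p ⟩
    suc k + deg P3 p        ≤⟨ +-monoʳ-≤ (suc k) (deg-P3≤2 p) ⟩
    suc k + 2               ≤⟨ gap ⟩
    n                       <⟨ m<m+n n (deg-P3-positive q) ⟩
    n + deg P3 q            ≡⟨ deg□-apex q ⟨
    deg□ G P3 (zero , q)    ∎
    where open ≤-Reasoning

  deg□-layer0≢layer1 : ∀ h h' → deg□ G P3 (suc h , 0F) ≢ deg□ G P3 (suc h' , 1F)
  deg□-layer0≢layer1 h h' eq
    with () ← +-cancelˡ-≡ (suc k) 1 2 (trans (sym (deg□-base h 0F)) (trans eq (deg□-base h' 1F)))

  layerColor : Fin 3 → Fin (suc (suc c)) → Palette
  layerColor 0F i = 0F , i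
  layerColor 1F i = 0F , cyclicPred i
  layerColor 2F i = 1F , i

  apexColor : Fin 3 → Palette
  apexColor 0F = 1F , 0F
  apexColor 1F = 1F , 1F
  apexColor 2F = 0F , 0F

  color : Vertex → Palette
  color (zero  , p) = apexColor p
  color (suc h , p) = layerColor p (f h)

  apexColor-injective : ∀ {p q} → apexColor p ≡ apexColor q → p ≡ q
  apexColor-injective {0F} {0F} _ = refl
  apexColor-injective {1F} {1F} _ = refl
  apexColor-injective {2F} {2F} _ = refl
  apexColor-injective {0F} {1F} ()
  apexColor-injective {0F} {2F} ()
  apexColor-injective {1F} {0F} ()
  apexColor-injective {1F} {2F} ()
  apexColor-injective {2F} {0F} ()
  apexColor-injective {2F} {1F} ()

  apexColor≡layerColor⇒≢ : ∀ {p q i} → apexColor p ≡ layerColor q i → p ≢ q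
  apexColor≡layerColor⇒≢ {0F} () refl
  apexColor≡layerColor⇒≢ {1F} () refl
  apexColor≡layerColor⇒≢ {2F} () refl

  agrees-apart : ∀ x p x' q → x ≢ x' → p ≢ q → deg□ G P3 (x , p) ≢ deg□ G P3 (x' , q) →
    Agrees (x , p) (x' , q)
  agrees-apart _ _ _ _ x≢x' p≢q d≢d' = trans (□-nonadjacent G P3 x≢x' p≢q) (sym (dec-false (_ ≟ _) d≢d'))

  agrees-sameLayer : ∀ {h h' p} → _≢_ {A = Vertex} (suc h , p) (suc h' , p) → f h ≡ f h' →
    Agrees (suc h , p) (suc h' , p)
  agrees-sameLayer {h} {h'} {p} a≢b fh≡fh' = begin
    (G □ P3) (suc h , p) (suc h' , p)  ≡⟨ □-layer G P3 sh≢sh' ⟩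
    H h h'                             ≡⟨ f-classes-are-cliques (sh≢sh' ∘ cong suc) fh≡fh' ⟩
    true                               ≡⟨ dec-true (_ ≟ _) sameDegree ⟨
    does (deg□ G P3 (suc h , p) ≟ deg□ G P3 (suc h' , p)) ∎
    where
    open ≡-Reasoning
    sh≢sh' = a≢b ∘ cong (_, p)
    sameDegree = trans (deg□-base h p) (sym (deg□-base h' p))

  shifted⇒distinct : ∀ {h h'} → f h ≡ cyclicPred (f h') → suc h ≢ suc h'
  shifted⇒distinct eq refl = cyclicPred-fixedPointFree _ (sym eq)

  base-classes : ∀ p q {h h'} → _≢_ {A = Vertex} (suc h , p) (suc h' , q) →
    layerColor p (f h) ≡ layerColor q (f h') → Agrees (suc h , p) (suc h' , q)
  base-classes 0F 0F a≢b eq = agrees-sameLayer a≢b (cong proj₂ eq)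
  base-classes 1F 1F a≢b eq = agrees-sameLayer a≢b (cyclicPred-injective (cong proj₂ eq))
  base-classes 2F 2F a≢b eq = agrees-sameLayer a≢b (cong proj₂ eq)
  base-classes 0F 1F {h} {h'} _ eq = agrees-apart (suc h) 0F (suc h') 1F
    (shifted⇒distinct (cong proj₂ eq)) (λ ()) (deg□-layer0≢layer1 h h')
  base-classes 1F 0F {h} {h'} _ eq = agrees-apart (suc h) 1F (suc h') 0F
    (shifted⇒distinct (sym (cong proj₂ eq)) ∘ sym) (λ ()) (deg□-layer0≢layer1 h' h ∘ sym)
  base-classes 0F 2F _ ()
  base-classes 1F 2F _ ()
  base-classes 2F 0F _ ()
  base-classes 2F 1F _ ()

  color-classes : ∀ a b → a ≢ b → color a ≡ color b → Agrees a b
  color-classes (zero , p) (zero , q) a≢b eq =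
    contradiction (cong (zero ,_) (apexColor-injective eq)) a≢b
  color-classes (zero , p) (suc h , q) _ eq =
    agrees-apart zero p (suc h) q (λ ()) (apexColor≡layerColor⇒≢ eq) (>⇒≢ (deg□-base<apex h q p))
  color-classes (suc h , p) (zero , q) _ eq =
    agrees-apart (suc h) p zero q (λ ()) (apexColor≡layerColor⇒≢ (sym eq) ∘ sym) (<⇒≢ (deg□-base<apex h p q))
  color-classes (suc h , p) (suc h' , q) a≢b eq = base-classes p q a≢b eq

  coloring : Colorable (deltaComp (cart G P3)) (2 * suc (suc c))
  coloring = cart-δ-coloring G P3 (joinVertex-irrefl H H-irrefl) (uncurry combine ∘ color) λ a b a≢b eq →
    color-classes a b a≢b (uncurry (cong₂ _,_) (combine-injective _ _ _ _ eq))

mainTheorem10 : (n k : ℕ) (H : Adj n) → IsSimple H → Regular H k → n ≥ 3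
    → (c : ℕ) → IsDeltaChromaticNumber H c → c ≥ 2
    → n > k + 2
    → Colorable (deltaComp (cart (joinVertex H) P3)) (2 * c)
-- Only the colouring part of χ_δ(H) = c is needed, and n ≥ 3 already follows from n > k + 2.
mainTheorem10 n k H simple regular _ c (col , _) (s≤s (s≤s _)) gap =
  JoinPathColoring.coloring H (IsSimple.irrefl simple) regular gap col
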